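{- (a) For every finite simple graph $G$, the dominator chromatic number $\chi_d(G)$ equals the Dom-compelling chromatic number of $G$. (b) For every finite simple graph $G$ without isolated vertices, the total dominator chromatic number $\chi_{td}(G)$ equals the TDom-compelling chromatic number of $G$.
   Context: A proper coloring of $G$ with $k$ colors partitions $V(G)$ into $k$ nonempty independent sets (color classes). Given a proper coloring, a rainbow committee (RC) is a set consisting of exactly one vertex of each color. For a property $\mathcal{P}$ of subsets of $V(G)$, a proper coloring compels $\mathcal{P}$ (is $\mathcal{P}$-compelling) if every RC has property $\mathcal{P}$; the $\mathcal{P}$-compelling chromatic number $\chi_{\mathcal{P}}(G)$ is the minimum number of colors in a $\mathcal{P}$-compelling proper coloring. Property Dom: every vertex of $G$ is in the RC or has a neighbor in the RC. Property TDom: every vertex of $G$ has a neighbor in the RC. A dominator coloring is a proper coloring in which every vertex either forms a singleton color class or is adjacent to every vertex of some other color class; $\chi_d(G)$ is the minimum number of colors in a dominator coloring. For $G$ without isolated vertices, a total dominator coloring is a proper coloring in which every vertex is adjacent to every vertex of some color class other than its own; $\chi_{td}(G)$ is the minimum number of colors in such a coloring. -}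

module Defs where

open import Data.Nat using (ℕ; _≤_)
open import Data.Fin using (Fin)
open import Data.Bool using (Bool; true; false)
open import Data.Product using (Σ; ∃; ∃-syntax; _×_; _,_)
open import Data.Sum using (_⊎_)
open import Relation.Binary.PropositionalEquality using (_≡_; _≢_)

record Graph (n : ℕ) : Set where
  field
    adj   : Fin n → Fin n → Bool
    sym   : ∀ u v → adj u v ≡ adj v u
    irref : ∀ v → adj v v ≡ false
open Graph public

Adj : ∀ {n} → Graph n → Fin n → Fin n → Set
Adj G u v = adj G u v ≡ true

NoIsolated : ∀ {n} → Graph n → Set
NoIsolated G = ∀ v → ∃[ u ] Adj G v u

-- A proper coloring with exactly k colors: every color class is nonempty
-- (the coloring map is surjective) and adjacent vertices get different colors.
record ProperColoring {n} (G : Graph n) (k : ℕ) : Set where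
  field
    col    : Fin n → Fin k
    surj   : ∀ (i : Fin k) → ∃[ v ] col v ≡ i
    proper : ∀ u v → Adj G u v → col u ≢ col v
open ProperColoring public

-- A rainbow committee is given by a choice r i of one vertex of each color i;
-- the committee (as a subset of V(G)) is the image of r.
IsRainbowChoice : ∀ {n k} {G : Graph n} → ProperColoring G k → (Fin k → Fin n) → Set
IsRainbowChoice c r = ∀ i → col c (r i) ≡ i

InImage : ∀ {n k} → (Fin k → Fin n) → Fin n → Set
InImage r v = ∃[ i ] r i ≡ v

DomProp : ∀ {n k} → Graph n → (Fin k → Fin n) → Set
DomProp G r = ∀ v → InImage r v ⊎ (∃[ i ] Adj G v (r i))

TDomProp : ∀ {n k} → Graph n → (Fin k → Fin n) → Set
TDomProp G r = ∀ v → ∃[ i ] Adj G v (r i)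

Compels : ∀ {n k} {G : Graph n} → ((Fin k → Fin n) → Set) → ProperColoring G k → Set
Compels {n} {k} P c = ∀ (r : Fin k → Fin n) → IsRainbowChoice c r → P r

IsDominatorColoring : ∀ {n k} {G : Graph n} → ProperColoring G k → Set
IsDominatorColoring {G = G} c =
  ∀ v → (∀ u → col c u ≡ col c v → u ≡ v)
      ⊎ (∃[ j ] (j ≢ col c v × (∀ u → col c u ≡ j → Adj G v u)))

IsTotalDominatorColoring : ∀ {n k} {G : Graph n} → ProperColoring G k → Set
IsTotalDominatorColoring {G = G} c =
  ∀ v → ∃[ j ] (j ≢ col c v × (∀ u → col c u ≡ j → Adj G v u))

Admits : ∀ {n} (G : Graph n) → (∀ {k} → ProperColoring G k → Set) → ℕ → Set
Admits G Q k = Σ (ProperColoring G k) λ c → Q c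

IsMinimum : (ℕ → Set) → ℕ → Set
IsMinimum P k = P k × (∀ m → P m → k ≤ m)

IsDominatorChromaticNumber : ∀ {n} → Graph n → ℕ → Set
IsDominatorChromaticNumber G = IsMinimum (Admits G IsDominatorColoring)

IsTotalDominatorChromaticNumber : ∀ {n} → Graph n → ℕ → Set
IsTotalDominatorChromaticNumber G = IsMinimum (Admits G IsTotalDominatorColoring)

IsDomCompellingChromaticNumber : ∀ {n} → Graph n → ℕ → Set
IsDomCompellingChromaticNumber G = IsMinimum (Admits G (λ c → Compels (DomProp G) c))

IsTDomCompellingChromaticNumber : ∀ {n} → Graph n → ℕ → Set
IsTDomCompellingChromaticNumber G = IsMinimum (Admits G (λ c → Compels (TDomProp G) c))

{-# OPTIONS --safe #-}
-- A vertex v that is neither alone in its color class nor adjacent to a whole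
-- other class has, in every class, a vertex that is neither v nor a neighbour
-- of v (in its own class a classmate, in any other class a non-neighbour).
-- Picking one such vertex per color gives a rainbow committee that does not
-- dominate v; conversely the condition of a dominator coloring visibly makes
-- every committee dominate v. So the colorings with either property coincide
-- for each number of colors, hence so do the minima, and these minima exist
-- because both properties are decidable for a finite graph and the discrete
-- coloring has them. The total version is the same argument, where the own
-- class needs no classmate since no vertex is adjacent to its own class.
module Submission where

open import Defs
open import Data.Nat using (ℕ; zero; suc; z≤n; s≤s)
open import Data.Fin using (Fin; _≟_)
open import Data.Fin.Properties using (any?; all?; ¬∀⟶∃¬)
open import Data.Bool using (true)
import Data.Bool.Properties as Bool
open import Data.Vec.Functional using (Vector; []; _∷_; head; tail)
open import Data.Vec.Functional.Properties using (∷-cong)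
open import Data.Product using (∃; ∃-syntax; _×_; _,_; proj₁; proj₂)
open import Data.Sum as Sum using (_⊎_; inj₁; inj₂)
open import Function using (_∘_; _⇔_; mk⇔; Equivalence)
open import Relation.Nullary using (¬_; Dec; yes; no; contradiction)
open import Relation.Nullary.Decidable using (map′; _×-dec_; _⊎-dec_; _→-dec_; ¬?)
open import Relation.Unary using (Pred; Decidable)
open import Relation.Binary.PropositionalEquality using (_≡_; _≢_; _≗_; refl; cong; trans; subst)
  renaming (sym to ≡-sym)

private
  variable
    n k : ℕ

minimum-exists : {P : ℕ → Set} → (∀ m → Dec (P m)) → ∀ {m} → P m → ∃ (IsMinimum P)
minimum-exists P? {m} pm with P? 0
... | yes p₀ = 0 , p₀ , λ _ _ → z≤n
minimum-exists P? {zero}  pm | no ¬p₀ = contradiction pm ¬p₀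
minimum-exists P? {suc m} pm | no ¬p₀ with minimum-exists (P? ∘ suc) pm
... | k , pk , least = suc k , pk , λ where
  zero    p₀ → contradiction p₀ ¬p₀
  (suc l) pl → s≤s (least l pl)

IsMinimum-cong : {P Q : ℕ → Set} → (∀ m → P m ⇔ Q m) → ∀ {k} → IsMinimum P k → IsMinimum Q k
IsMinimum-cong P⇔Q {k} (pk , least) =
  Equivalence.to (P⇔Q k) pk , λ m qm → least m (Equivalence.from (P⇔Q m) qm)

any-vector? : ∀ {ℓ} {P : Pred (Vector (Fin k) n) ℓ} →
              (∀ {f g} → f ≗ g → P f → P g) → Decidable P → Dec (∃ P)
any-vector? {n = zero} resp P? =
  map′ (λ p → [] , p) (λ (f , p) → resp (λ ()) p) (P? [])
any-vector? {n = suc n} resp P? =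
  map′ (λ (x , xs , p) → x ∷ xs , p)
       (λ (f , p) → head f , tail f , resp (∷-cong refl λ _ → refl) p)
       (any? λ x → any-vector? (resp ∘ ∷-cong refl) (P? ∘ (x ∷_)))

module _ (G : Graph n) where

  adj? : ∀ u v → Dec (Adj G u v)
  adj? u v = adj G u v Bool.≟ true

  Solitary : (Fin n → Fin k) → Fin n → Set
  Solitary f v = ∀ u → f u ≡ f v → u ≡ v

  DominatesClass : (Fin n → Fin k) → Fin n → Fin k → Set
  DominatesClass f v j = ∀ u → f u ≡ j → Adj G v u

  DominatesOtherClass : (Fin n → Fin k) → Fin n → Set
  DominatesOtherClass f v = ∃[ j ] (j ≢ f v × DominatesClass f v j)

  -- IsDominatorColoring c and IsTotalDominatorColoring c unfold to these
  -- predicates on col c, which lets them be decided by searching color maps.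
  IsDominatorMap : (Fin n → Fin k) → Set
  IsDominatorMap f = ∀ v → Solitary f v ⊎ DominatesOtherClass f v

  IsTotalDominatorMap : (Fin n → Fin k) → Set
  IsTotalDominatorMap f = ∀ v → DominatesOtherClass f v

  solitary? : (f : Fin n → Fin k) → ∀ v → Dec (Solitary f v)
  solitary? f v = all? λ u → f u ≟ f v →-dec u ≟ v

  dominatesOtherClass? : (f : Fin n → Fin k) → ∀ v → Dec (DominatesOtherClass f v)
  dominatesOtherClass? f v =
    any? λ j → ¬? (j ≟ f v) ×-dec all? λ u → f u ≟ j →-dec adj? v u

  solitary-resp : {f g : Fin n → Fin k} → f ≗ g → ∀ {v} → Solitary f v → Solitary g v
  solitary-resp f≗g {v} sol u gu≡gv = sol u (trans (f≗g u) (trans gu≡gv (≡-sym (f≗g v))))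

  dominatesOtherClass-resp : {f g : Fin n → Fin k} → f ≗ g →
                             ∀ {v} → DominatesOtherClass f v → DominatesOtherClass g v
  dominatesOtherClass-resp f≗g {v} (j , j≢fv , dom) =
    j , (λ j≡gv → j≢fv (trans j≡gv (≡-sym (f≗g v)))) , λ u gu≡j → dom u (trans (f≗g u) gu≡j)

  IsProperMap : (Fin n → Fin k) → Set
  IsProperMap f = ∀ u v → Adj G u v → f u ≢ f v

  IsSurjectiveMap : (Fin n → Fin k) → Set
  IsSurjectiveMap {k = k} f = ∀ (i : Fin k) → ∃[ v ] f v ≡ i

  admits? : (Q : ∀ {k} → (Fin n → Fin k) → Set) →
            (∀ {k} {f g : Fin n → Fin k} → f ≗ g → Q f → Q g) →
            (∀ {k} (f : Fin n → Fin k) → Dec (Q f)) →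
            ∀ k → Dec (Admits G (λ c → Q (col c)) k)
  admits? Q Q-resp Q? k =
    map′ (λ (f , surj , proper , q) → record { col = f ; surj = surj ; proper = proper } , q)
         (λ (c , q) → col c , surj c , proper c , q)
         (any-vector? resp λ f → surjective? f ×-dec proper? f ×-dec Q? f)
    where
    surjective? : (f : Fin n → Fin k) → Dec (IsSurjectiveMap f)
    surjective? f = all? λ i → any? λ v → f v ≟ i
    proper? : (f : Fin n → Fin k) → Dec (IsProperMap f)
    proper? f = all? λ u → all? λ v → adj? u v →-dec ¬? (f u ≟ f v)
    resp : {f g : Fin n → Fin k} → f ≗ g →
           IsSurjectiveMap f × IsProperMap f × Q f → IsSurjectiveMap g × IsProperMap g × Q g
    resp f≗g (surj , proper , q) =
      (λ i → let v , fv≡i = surj i in v , trans (≡-sym (f≗g v)) fv≡i) ,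
      (λ u v uv gu≡gv → proper u v uv (trans (f≗g u) (trans gu≡gv (≡-sym (f≗g v))))) ,
      Q-resp f≗g q

  irreflexive : ∀ v → ¬ Adj G v v
  irreflexive v vv with trans (≡-sym (irref G v)) vv
  ... | ()

  discrete : ProperColoring G n
  discrete = record
    { col    = λ v → v
    ; surj   = λ i → i , refl
    ; proper = λ u v uv u≡v → irreflexive v (subst (λ w → Adj G w v) u≡v uv)
    }

  discrete-isDominator : IsDominatorColoring discrete
  discrete-isDominator v = inj₁ λ u u≡v → u≡v

  discrete-isTotalDominator : NoIsolated G → IsTotalDominatorColoring discrete
  discrete-isTotalDominator noIsolated v =
    let u , vu = noIsolated v
    in u , (λ u≡v → irreflexive v (subst (Adj G v) u≡v vu)) , λ w w≡u → subst (Adj G v) (≡-sym w≡u) vu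

  dominatorColorable? : ∀ k → Dec (Admits G IsDominatorColoring k)
  dominatorColorable? =
    admits? IsDominatorMap
            (λ f≗g dom v → Sum.map (solitary-resp f≗g) (dominatesOtherClass-resp f≗g) (dom v))
            (λ f → all? λ v → solitary? f v ⊎-dec dominatesOtherClass? f v)

  totalDominatorColorable? : ∀ k → Dec (Admits G IsTotalDominatorColoring k)
  totalDominatorColorable? =
    admits? IsTotalDominatorMap (λ f≗g dom v → dominatesOtherClass-resp f≗g (dom v))
            (λ f → all? (dominatesOtherClass? f))

  Admits-cong : {Q R : ∀ {k} → ProperColoring G k → Set} →
                (∀ {k} (c : ProperColoring G k) → Q c ⇔ R c) → ∀ k → Admits G Q k ⇔ Admits G R k
  Admits-cong Q⇔R k = mk⇔ (λ (c , q) → c , Equivalence.to (Q⇔R c) q)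
                          (λ (c , r) → c , Equivalence.from (Q⇔R c) r)

module _ {G : Graph n} (c : ProperColoring G k) where

  same-color⇒¬adjacent : ∀ {u v} → col c u ≡ col c v → ¬ Adj G v u
  same-color⇒¬adjacent cu≡cv vu = proper c _ _ vu (≡-sym cu≡cv)

  rainbow-choice : {A : Fin n → Set} → (∀ j → ∃[ u ] (col c u ≡ j × A u)) →
                   ∃[ r ] (IsRainbowChoice c r × ∀ j → A (r j))
  rainbow-choice w = proj₁ ∘ w , proj₁ ∘ proj₂ ∘ w , proj₂ ∘ proj₂ ∘ w

  class-counterexample : {B : Fin n → Set} → Decidable B →
                         ∀ {j} → ¬ (∀ u → col c u ≡ j → B u) → ∃[ u ] (col c u ≡ j × ¬ B u)
  class-counterexample B? {j} ¬all with ¬∀⟶∃¬ n _ (λ u → col c u ≟ j →-dec B? u) ¬all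
  ... | u , ¬[cu≡j→Bu] with col c u ≟ j
  ... | yes cu≡j = u , cu≡j , λ bu → ¬[cu≡j→Bu] λ _ → bu
  ... | no  cu≢j = contradiction (λ cu≡j → contradiction cu≡j cu≢j) ¬[cu≡j→Bu]

  non-neighbour-in-class : ∀ {v j} → ¬ DominatesOtherClass G (col c) v → j ≢ col c v →
                           ∃[ u ] (col c u ≡ j × ¬ Adj G v u)
  non-neighbour-in-class {v} ¬dom j≢cv =
    class-counterexample (adj? G v) λ dom → ¬dom (_ , j≢cv , dom)

  dominator⇒compelsDom : IsDominatorColoring c → Compels (DomProp G) c
  dominator⇒compelsDom dom r rainbow v with dom v
  ... | inj₁ sol            = inj₁ (col c v , sol (r (col c v)) (rainbow (col c v)))
  ... | inj₂ (j , _ , domj) = inj₂ (j , domj (r j) (rainbow j))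

  compelsDom⇒dominator : Compels (DomProp G) c → IsDominatorColoring c
  compelsDom⇒dominator compels v with solitary? G (col c) v | dominatesOtherClass? G (col c) v
  ... | yes sol | _       = inj₁ sol
  ... | no _    | yes dom = inj₂ dom
  ... | no ¬sol | no ¬dom with rainbow-choice avoider
    where
    avoider : ∀ j → ∃[ u ] (col c u ≡ j × u ≢ v × ¬ Adj G v u)
    avoider j with j ≟ col c v
    ... | yes refl = let u , cu≡cv , u≢v = class-counterexample (_≟ v) ¬sol
                     in u , cu≡cv , u≢v , same-color⇒¬adjacent cu≡cv
    ... | no j≢cv  = let u , cu≡j , ¬vu = non-neighbour-in-class ¬dom j≢cv
                     in u , cu≡j , (λ u≡v → j≢cv (trans (≡-sym cu≡j) (cong (col c) u≡v))) , ¬vu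
  ... | r , rainbow , avoids with compels r rainbow v
  ... | inj₁ (i , ri≡v) = contradiction ri≡v (proj₁ (avoids i))
  ... | inj₂ (i , vri)  = contradiction vri (proj₂ (avoids i))

  dominator⇔compelsDom : IsDominatorColoring c ⇔ Compels (DomProp G) c
  dominator⇔compelsDom = mk⇔ dominator⇒compelsDom compelsDom⇒dominator

  totalDominator⇒compelsTDom : IsTotalDominatorColoring c → Compels (TDomProp G) c
  totalDominator⇒compelsTDom dom r rainbow v =
    let j , _ , domj = dom v in j , domj (r j) (rainbow j)

  compelsTDom⇒totalDominator : Compels (TDomProp G) c → IsTotalDominatorColoring c
  compelsTDom⇒totalDominator compels v with dominatesOtherClass? G (col c) v
  ... | yes dom = dom
  ... | no ¬dom with rainbow-choice avoider
    where
    avoider : ∀ j → ∃[ u ] (col c u ≡ j × ¬ Adj G v u)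
    avoider j with j ≟ col c v
    ... | yes refl = let u , cu≡cv = surj c j in u , cu≡cv , same-color⇒¬adjacent cu≡cv
    ... | no j≢cv  = non-neighbour-in-class ¬dom j≢cv
  ... | r , rainbow , avoids = let i , vri = compels r rainbow v in contradiction vri (avoids i)

  totalDominator⇔compelsTDom : IsTotalDominatorColoring c ⇔ Compels (TDomProp G) c
  totalDominator⇔compelsTDom = mk⇔ totalDominator⇒compelsTDom compelsTDom⇒totalDominator

mainTheorem1 :
    (∀ (n : ℕ) (G : Graph n) →
       ∃[ k ] (IsDominatorChromaticNumber G k × IsDomCompellingChromaticNumber G k))
    × (∀ (n : ℕ) (G : Graph n) → NoIsolated G →
       ∃[ k ] (IsTotalDominatorChromaticNumber G k × IsTDomCompellingChromaticNumber G k))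
mainTheorem1 = dominator , totalDominator
  where
  dominator : ∀ n (G : Graph n) →
              ∃[ k ] (IsDominatorChromaticNumber G k × IsDomCompellingChromaticNumber G k)
  dominator n G =
    let k , χd = minimum-exists (dominatorColorable? G) (discrete G , discrete-isDominator G)
    in k , χd , IsMinimum-cong (Admits-cong G dominator⇔compelsDom) χd

  totalDominator : ∀ n (G : Graph n) → NoIsolated G →
                   ∃[ k ] (IsTotalDominatorChromaticNumber G k × IsTDomCompellingChromaticNumber G k)
  totalDominator n G noIsolated =
    let k , χtd = minimum-exists (totalDominatorColorable? G)
                                 (discrete G , discrete-isTotalDominator G noIsolated)
    in k , χtd , IsMinimum-cong (Admits-cong G totalDominator⇔compelsTDom) χtd
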